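{- With the interpretation $\mathcal I$ of a signature over $\mathrm{Pow}_\sigma(\mathrm{Points})$ described below, for every predicate $\phi$ we have $[\![\phi]\!]=\{p\in\mathrm{Points}\mid\phi\in p\}$.
   Context: Atoms $\mathbb A$ (countably infinite; $a,b,c$ distinct), permutations, swappings $(a\ b)$, nominal support $\mathrm{supp}$, freshness $a\#x$, and $\mathsf N a$ = "for all but finitely many atoms $a$". Syntax: terms $r::=a\mid\mathsf f(r_1..r_n)$; predicates $\phi::=\bot\mid r=r\mid\mathsf P(\vec r)\mid\phi\wedge\phi\mid\neg\phi\mid\forall a.\phi$ up to $\alpha$-equivalence, with capture-avoiding substitution $\phi[a:=r]$; permutations act by renaming atoms; $\top=\neg\bot$, $\phi\vee\psi=\neg(\neg\phi\wedge\neg\psi)$. $\phi\vdash\psi$ denotes derivability in the standard classical sequent calculus of first-order logic with equality. A filter is a nonempty set $p$ of predicates (not necessarily finitely supported) with: $\bot\notin p$; $\phi\in p$ and $\phi\vdash\phi'$ imply $\phi'\in p$; $\phi,\phi'\in p$ imply $\phi\wedge\phi'\in p$; if $\mathsf N b.\,(b\ a)\cdot\phi\in p$ then $\forall a.\phi\in p$. It is prime if $\phi_1\vee\phi_2\in p$ implies $\phi_1\in p$ or $\phi_2\in p$. $\mathrm{Points}$ is the set of prime filters, with $\pi\cdot p=\{\pi\cdot\phi\mid\phi\in p\}$ and $p[r\Leftarrow a]=\{\phi\mid\phi[a:=r]\in p\}$ for terms $r$. For $X\subseteq\mathrm{Points}$: $\pi\cdot X$ pointwise and $X[a:=r]=\{p\mid\mathsf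 N c.\ p[r\Leftarrow c]\in(c\ a)\cdot X\}$. $\mathrm{Pow}_\sigma(\mathrm{Points})$ is the set of finitely supported $X\subseteq\mathrm{Points}$ with (1) $\forall r\,\mathsf N a\,\forall p\,(p[r\Leftarrow a]\in X\iff p\in X)$ and (2) $\forall a\,\mathsf N b\,\forall p\,(p[b\Leftarrow a]\in X\iff(b\ a)\cdot p\in X)$. Interpretation $\mathcal I$: terms interpreted as themselves ($[\![r]\!]=r$, with real substitution); $\mathsf P^{\mathcal I}(a_1,..,a_n)=\{p\mid\mathsf P(a_1,..,a_n)\in p\}$ and $\mathsf P^{\mathcal I}(r_1,..,r_n)=\mathsf P^{\mathcal I}(a_1,..,a_n)[a_1:=r_1]\cdots[a_n:=r_n]$ for distinct atoms $a_i$ fresh for the $r_j$; and $[\![\bot]\!]=\emptyset$, $[\![r=s]\!]=\{p\mid\mathsf N c.\ p[r\Leftarrow c]=p[s\Leftarrow c]\}$, $[\![\mathsf P(\vec r)]\!]=\mathsf P^{\mathcal I}(\vec r)$, $[\![\phi\wedge\psi]\!]=[\![\phi]\!]\cap[\![\psi]\!]$, $[\![\neg\phi]\!]=\mathrm{Points}\setminus[\![\phi]\!]$, $[\![\forall a.\phi]\!]=\bigcap_{r}[\![\phi]\!][a:=r]$ ($r$ ranging over all terms). -}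

module Defs where

open import Data.Nat using (ℕ; zero; suc; _+_; _⊔_)
open import Data.Nat.Properties using (_≟_)
open import Data.Fin using (Fin; zero; suc; toℕ)
open import Data.Vec using (Vec; []; _∷_; toList; tabulate)
open import Data.List using (List; []; _∷_; _++_; foldr; foldl; concatMap; zip)
open import Data.List.Membership.Propositional using (_∈_; _∉_)
open import Data.Product using (Σ; _×_; _,_)
open import Data.Sum using (_⊎_)
open import Data.Empty using (⊥)
open import Data.Bool using (if_then_else_)
open import Relation.Nullary using (¬_)
open import Relation.Nullary.Decidable using (⌊_⌋)
open import Function.Bundles using (_⇔_)

-- Atoms: ℕ (countably infinite, decidable equality)

Atom : Set
Atom = ℕ

swapA : Atom → Atom → Atom → Atom
swapA a b c = if ⌊ c ≟ a ⌋ then b else (if ⌊ c ≟ b ⌋ then a else c)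

-- "N a. P a": for all but finitely many atoms
N : (Atom → Set) → Set
N P = Σ (List Atom) λ l → (a : Atom) → a ∉ l → P a

fresh : List Atom → Atom
fresh l = suc (foldr _⊔_ 0 l)

record Signature : Set₁ where
  field
    FunSym   : Set
    farity   : FunSym → ℕ
    PredSym  : Set
    parity   : PredSym → ℕ

module Logic (S : Signature) where
  open Signature S

  -- Syntax up to α-equivalence: free variables are atoms, bound variables
  -- are scoped de Bruijn indices (index zero = innermost binder).
  data Tm (n : ℕ) : Set where
    atom : Atom → Tm n
    bvar : Fin n → Tm n
    fun  : (f : FunSym) → Vec (Tm n) (farity f) → Tm n

  data Fm (n : ℕ) : Set where
    bot : Fm n
    eq  : Tm n → Tm n → Fm n
    rel : (P : PredSym) → Vec (Tm n) (parity P) → Fm n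
    and : Fm n → Fm n → Fm n
    neg : Fm n → Fm n
    all : Fm (suc n) → Fm n

  -- terms and predicates of the paper (closed: no dangling bound variables)
  Term : Set
  Term = Tm 0

  Pred : Set
  Pred = Fm 0

  mutual
    substT : ∀ {n m} → (Atom → Tm m) → (Fin n → Tm m) → Tm n → Tm m
    substT σ τ (atom a) = σ a
    substT σ τ (bvar i) = τ i
    substT σ τ (fun f ts) = fun f (substTs σ τ ts)

    substTs : ∀ {n m k} → (Atom → Tm m) → (Fin n → Tm m) → Vec (Tm n) k → Vec (Tm m) k
    substTs σ τ [] = []
    substTs σ τ (t ∷ ts) = substT σ τ t ∷ substTs σ τ ts

  wkT : ∀ {m} → Tm m → Tm (suc m)
  wkT = substT atom (λ i → bvar (suc i))

  liftB : ∀ {n m} → (Fin n → Tm m) → Fin (suc n) → Tm (suc m)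
  liftB τ zero = bvar zero
  liftB τ (suc i) = wkT (τ i)

  substF : ∀ {n m} → (Atom → Tm m) → (Fin n → Tm m) → Fm n → Fm m
  substF σ τ bot = bot
  substF σ τ (eq t u) = eq (substT σ τ t) (substT σ τ u)
  substF σ τ (rel P ts) = rel P (substTs σ τ ts)
  substF σ τ (and φ ψ) = and (substF σ τ φ) (substF σ τ ψ)
  substF σ τ (neg φ) = neg (substF σ τ φ)
  substF σ τ (all φ) = all (substF (λ a → wkT (σ a)) (liftB τ) φ)

  mutual
    atomsT : ∀ {n} → Tm n → List Atom
    atomsT (atom a) = a ∷ []
    atomsT (bvar i) = []
    atomsT (fun f ts) = atomsTs ts

    atomsTs : ∀ {n k} → Vec (Tm n) k → List Atom
    atomsTs [] = []
    atomsTs (t ∷ ts) = atomsT t ++ atomsTs ts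

  atomsF : ∀ {n} → Fm n → List Atom
  atomsF bot = []
  atomsF (eq t u) = atomsT t ++ atomsT u
  atomsF (rel P ts) = atomsTs ts
  atomsF (and φ ψ) = atomsF φ ++ atomsF ψ
  atomsF (neg φ) = atomsF φ
  atomsF (all φ) = atomsF φ

  atomsL : List Pred → List Atom
  atomsL = concatMap atomsF

  close : ∀ {n} → Atom → Fm n → Fm (suc n)
  close a = substF (λ c → if ⌊ c ≟ a ⌋ then bvar zero else atom c) (λ i → bvar (suc i))

  ∀[_]_ : ∀ {n} → Atom → Fm n → Fm n
  ∀[ a ] φ = all (close a φ)

  ⊤' : ∀ {n} → Fm n
  ⊤' = neg bot

  _∨'_ : ∀ {n} → Fm n → Fm n → Fm n
  φ ∨' ψ = neg (and (neg φ) (neg ψ))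

  _[_≔_] : Pred → Atom → Term → Pred
  φ [ a ≔ r ] = substF (λ c → if ⌊ c ≟ a ⌋ then r else atom c) bvar φ

  swapF : Atom → Atom → Pred → Pred
  swapF a b = substF (λ c → atom (swapA a b c)) bvar

  inst : Fm 1 → Term → Pred
  inst ψ r = substF atom (λ _ → r) ψ

  -- Classical sequent calculus for first-order logic with equality
  -- (G3-style, principal formulas retained; cut included)

  data _⊢ₛ_ : List Pred → List Pred → Set where
    ax      : ∀ {Γ Δ φ} → φ ∈ Γ → φ ∈ Δ → Γ ⊢ₛ Δ
    botL    : ∀ {Γ Δ} → bot ∈ Γ → Γ ⊢ₛ Δ
    andL    : ∀ {Γ Δ φ ψ} → and φ ψ ∈ Γ → (φ ∷ ψ ∷ Γ) ⊢ₛ Δ → Γ ⊢ₛ Δ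
    andR    : ∀ {Γ Δ φ ψ} → and φ ψ ∈ Δ → Γ ⊢ₛ (φ ∷ Δ) → Γ ⊢ₛ (ψ ∷ Δ) → Γ ⊢ₛ Δ
    negL    : ∀ {Γ Δ φ} → neg φ ∈ Γ → Γ ⊢ₛ (φ ∷ Δ) → Γ ⊢ₛ Δ
    negR    : ∀ {Γ Δ φ} → neg φ ∈ Δ → (φ ∷ Γ) ⊢ₛ Δ → Γ ⊢ₛ Δ
    allL    : ∀ {Γ Δ ψ} → all ψ ∈ Γ → (r : Term) → (inst ψ r ∷ Γ) ⊢ₛ Δ → Γ ⊢ₛ Δ
    allR    : ∀ {Γ Δ ψ} (b : Atom) → all ψ ∈ Δ → b ∉ atomsL Γ → b ∉ atomsL Δ →
              Γ ⊢ₛ (inst ψ (atom b) ∷ Δ) → Γ ⊢ₛ Δ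
    eqRefl  : ∀ {Γ Δ} (r : Term) → (eq r r ∷ Γ) ⊢ₛ Δ → Γ ⊢ₛ Δ
    eqSubst : ∀ {Γ Δ r s} → eq r s ∈ Γ → (ψ : Fm 1) → inst ψ r ∈ Γ →
              (inst ψ s ∷ Γ) ⊢ₛ Δ → Γ ⊢ₛ Δ
    cut     : ∀ {Γ Δ} (φ : Pred) → Γ ⊢ₛ (φ ∷ Δ) → (φ ∷ Γ) ⊢ₛ Δ → Γ ⊢ₛ Δ

  _⊢_ : Pred → Pred → Set
  φ ⊢ ψ = (φ ∷ []) ⊢ₛ (ψ ∷ [])

  PSet : Set₁
  PSet = Pred → Set

  -- π·p = {π·φ | φ ∈ p}; for a swapping (a b) (an involution)
  swapP : Atom → Atom → PSet → PSet
  swapP a b p φ = p (swapF a b φ)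

  _[_⇐_] : PSet → Term → Atom → PSet
  (p [ r ⇐ a ]) φ = p (φ [ a ≔ r ])

  record IsFilter (p : PSet) : Set where
    field
      nonempty : Σ Pred p
      no-bot   : ¬ p bot
      up       : ∀ φ φ' → p φ → φ ⊢ φ' → p φ'
      meet     : ∀ φ φ' → p φ → p φ' → p (and φ φ')
      gen      : ∀ a φ → N (λ b → p (swapF b a φ)) → p (∀[ a ] φ)

  IsPrime : PSet → Set
  IsPrime p = ∀ φ₁ φ₂ → p (φ₁ ∨' φ₂) → p φ₁ ⊎ p φ₂

  IsPoint : PSet → Set
  IsPoint p = IsFilter p × IsPrime p

  -- A subset X ⊆ Points is represented by its membership predicate on
  -- PSet; every set constructed below only contains points.
  PtSet : Set₁
  PtSet = PSet → Set

  swapX : Atom → Atom → PtSet → PtSet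
  swapX a b X q = X (swapP a b q)

  _[_≔ₓ_] : PtSet → Atom → Term → PtSet
  (X [ a ≔ₓ r ]) p = IsPoint p × N (λ c → swapX c a X (p [ r ⇐ c ]))

  PIatoms : (P : PredSym) → Vec Atom (parity P) → PtSet
  PIatoms P as p = IsPoint p × p (rel P (Data.Vec.map atom as))

  -- P^I(r₁,…,rₙ) = P^I(a₁,…,aₙ)[a₁:=r₁]⋯[aₙ:=rₙ], aᵢ distinct, fresh for the rⱼ
  PI : (P : PredSym) → Vec Term (parity P) → PtSet
  PI P rs = foldl (λ X ar → X [ Data.Product.proj₁ ar ≔ₓ Data.Product.proj₂ ar ])
                  (PIatoms P as) (zip (toList as) (toList rs))
    where
      m : Atom
      m = fresh (atomsTs rs)
      as : Vec Atom (parity P)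
      as = tabulate (λ i → m + toℕ i)

  extEnv : ∀ {n} → Atom → (Fin n → Atom) → Fin (suc n) → Atom
  extEnv a ρ zero = a
  extEnv a ρ (suc i) = ρ i

  envT : ∀ {n} → (Fin n → Atom) → Tm n → Term
  envT ρ = substT atom (λ i → atom (ρ i))

  envTs : ∀ {n k} → (Fin n → Atom) → Vec (Tm n) k → Vec Term k
  envTs ρ = substTs atom (λ i → atom (ρ i))

  envAtoms : ∀ {n} → (Fin n → Atom) → List Atom
  envAtoms ρ = toList (tabulate ρ)

  -- ⟦φ⟧ρ is ⟦φ with its dangling bound variables named by ρ⟧;
  -- for ∀ the bound name a is chosen fresh.
  ⟦_⟧ : ∀ {n} → Fm n → (Fin n → Atom) → PtSet
  ⟦ bot ⟧ ρ p = ⊥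
  ⟦ eq t u ⟧ ρ p = IsPoint p ×
      N (λ c → (ψ : Pred) → (p [ envT ρ t ⇐ c ]) ψ ⇔ (p [ envT ρ u ⇐ c ]) ψ)
  ⟦ rel P ts ⟧ ρ p = PI P (envTs ρ ts) p
  ⟦ and φ ψ ⟧ ρ p = ⟦ φ ⟧ ρ p × ⟦ ψ ⟧ ρ p
  ⟦ neg φ ⟧ ρ p = IsPoint p × ¬ ⟦ φ ⟧ ρ p
  ⟦ all φ ⟧ ρ p = (r : Term) → (⟦ φ ⟧ (extEnv a ρ) [ a ≔ₓ r ]) p
    where
      a : Atom
      a = fresh (atomsF φ ++ envAtoms ρ)

  ⟦_⟧ᵖ : Pred → PtSet
  ⟦ φ ⟧ᵖ = ⟦ φ ⟧ (λ ())

-- The proof is by induction on φ, generalised to open formulas Fm n whose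
-- dangling bound variables are named by an environment ρ of atoms.  Writing
-- "X represents χ" for X = {q ∈ Points | χ ∈ q}, each connective preserves
-- representation by a filter axiom: ⊥ because ⊥ ∉ q, ∧ by closure under
-- meets and consequences, ¬ by primeness applied to χ ∨ ¬χ, ∀ by the
-- generalisation axiom together with ∀-elimination.  Equality, ∀ and
-- predicate symbols also need the semantic substitution lemma: if X
-- represents χ then X[a:=r] represents χ[a:=r].  It rests on points being
-- closed under swappings and under q ↦ q[r⇐c], which in turn needs
-- derivability to be invariant under injective renamings of atoms.
module Submission where

open import Defs
open import Data.Nat using (ℕ; zero; suc; _+_; _<_; _≤_; s≤s)
open import Data.Nat.Properties using (_≟_; m≤m⊔n; m≤n⇒m≤o⊔n; <-irrefl; ≤-refl; ≤-trans; n≤1+n; +-suc; +-identityʳ; <⇒≢; m<n⇒m<1+n)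
open import Data.Fin using (Fin; zero; suc; toℕ)
open import Data.Vec using (Vec; []; _∷_; toList; tabulate; map)
open import Data.Vec.Properties using (tabulate-cong; map-id; map-∘)
open import Data.List using (List; []; _∷_; _++_; foldl; zip)
open import Data.List.Membership.Propositional using (_∈_; _∉_)
open import Data.List.Membership.Propositional.Properties using (∈-++⁺ˡ; ∈-++⁺ʳ; ∈-++⁻)
open import Data.List.Relation.Unary.Any using (here; there)
open import Data.Product using (_×_; _,_; proj₁; proj₂)
open import Data.Sum using (inj₁; inj₂)
open import Data.Empty using (⊥; ⊥-elim)
open import Data.Bool using (if_then_else_)
open import Relation.Nullary using (¬_; Dec; yes; no)
open import Relation.Nullary.Decidable using (⌊_⌋)
open import Relation.Binary.PropositionalEquality using (_≡_; _≢_; ≢-sym; refl; sym; trans; cong; cong₂; subst; module ≡-Reasoning)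
open import Function.Bundles using (_⇔_; mk⇔; Equivalence)
open import Function.Definitions using (Injective)

if-≟-same : ∀ {ℓ} {T : Set ℓ} (x : Atom) (u v : T) → (if ⌊ x ≟ x ⌋ then u else v) ≡ u
if-≟-same x u v with x ≟ x
... | yes _ = refl
... | no x≢x = ⊥-elim (x≢x refl)

if-≟-diff : ∀ {ℓ} {T : Set ℓ} {x y : Atom} (u v : T) → x ≢ y → (if ⌊ x ≟ y ⌋ then u else v) ≡ v
if-≟-diff {x = x} {y} u v x≢y with x ≟ y
... | yes x≡y = ⊥-elim (x≢y x≡y)
... | no _ = refl

swap-left : ∀ a b → swapA a b a ≡ b
swap-left a b = if-≟-same a b _

swap-right : ∀ a b → swapA a b b ≡ a
swap-right a b with b ≟ a
... | yes refl = refl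
... | no _ = if-≟-same b a b

swap-other : ∀ {a b c} → c ≢ a → c ≢ b → swapA a b c ≡ c
swap-other {a} {b} {c} c≢a c≢b = trans (if-≟-diff b _ c≢a) (if-≟-diff a c c≢b)

swap-involutive : ∀ a b c → swapA a b (swapA a b c) ≡ c
swap-involutive a b c with c ≟ a
... | yes refl = swap-right a b
... | no c≢a with c ≟ b
...   | yes refl = swap-left a b
...   | no c≢b = swap-other c≢a c≢b

Inj : (Atom → Atom) → Set
Inj = Injective _≡_ _≡_

swap-injective : ∀ a b → Inj (swapA a b)
swap-injective a b {x} {y} e =
  trans (sym (swap-involutive a b x)) (trans (cong (swapA a b) e) (swap-involutive a b y))

swap-conjugate : ∀ (f : Atom → Atom) → Inj f → ∀ b a x → f (swapA b a x) ≡ swapA (f b) (f a) (f x)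
swap-conjugate f inj b a x with x ≟ b
... | yes refl = sym (swap-left (f x) (f a))
... | no x≢b with x ≟ a
...   | yes refl = sym (swap-right (f b) (f x))
...   | no x≢a = sym (swap-other (λ e → x≢b (inj e)) (λ e → x≢a (inj e)))

fresh-> : ∀ {x} l → x ∈ l → x < fresh l
fresh-> (y ∷ l) (here refl) = s≤s (m≤m⊔n y _)
fresh-> (y ∷ l) (there x∈l) with fresh-> l x∈l
... | s≤s x≤max = s≤s (m≤n⇒m≤o⊔n y x≤max)

fresh-∉ : ∀ l → fresh l ∉ l
fresh-∉ l m = <-irrefl refl (fresh-> l m)

∉-++ˡ : ∀ {x : Atom} {l₁} l₂ → x ∉ l₁ ++ l₂ → x ∉ l₁
∉-++ˡ l₂ x∉ m = x∉ (∈-++⁺ˡ m)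

∉-++ʳ : ∀ {x : Atom} l₁ {l₂} → x ∉ l₁ ++ l₂ → x ∉ l₂
∉-++ʳ l₁ x∉ m = x∉ (∈-++⁺ʳ l₁ m)

∉-∷-head : ∀ {x y : Atom} {l} → x ∉ y ∷ l → x ≢ y
∉-∷-head x∉ e = x∉ (here e)

∉-∷-tail : ∀ {x y : Atom} {l} → x ∉ y ∷ l → x ∉ l
∉-∷-tail x∉ m = x∉ (there m)

module TruthLemma (Sg : Signature) where
  open Signature Sg
  open Logic Sg
  open Equivalence

  mutual
    subst-fusionT : ∀ {n m k} (σ : Atom → Tm m) (τ : Fin n → Tm m) (σ' : Atom → Tm k) (τ' : Fin m → Tm k) (t : Tm n) →
      substT σ' τ' (substT σ τ t) ≡ substT (λ x → substT σ' τ' (σ x)) (λ i → substT σ' τ' (τ i)) t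
    subst-fusionT σ τ σ' τ' (atom x) = refl
    subst-fusionT σ τ σ' τ' (bvar i) = refl
    subst-fusionT σ τ σ' τ' (fun f ts) = cong (fun f) (subst-fusionTs σ τ σ' τ' ts)

    subst-fusionTs : ∀ {n m k j} (σ : Atom → Tm m) (τ : Fin n → Tm m) (σ' : Atom → Tm k) (τ' : Fin m → Tm k) (ts : Vec (Tm n) j) →
      substTs σ' τ' (substTs σ τ ts) ≡ substTs (λ x → substT σ' τ' (σ x)) (λ i → substT σ' τ' (τ i)) ts
    subst-fusionTs σ τ σ' τ' [] = refl
    subst-fusionTs σ τ σ' τ' (t ∷ ts) = cong₂ _∷_ (subst-fusionT σ τ σ' τ' t) (subst-fusionTs σ τ σ' τ' ts)

  mutual
    subst-congT : ∀ {n m} {σ σ' : Atom → Tm m} {τ τ' : Fin n → Tm m} (t : Tm n) →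
      (∀ x → x ∈ atomsT t → σ x ≡ σ' x) → (∀ i → τ i ≡ τ' i) → substT σ τ t ≡ substT σ' τ' t
    subst-congT (atom x) eqσ eqτ = eqσ x (here refl)
    subst-congT (bvar i) eqσ eqτ = eqτ i
    subst-congT (fun f ts) eqσ eqτ = cong (fun f) (subst-congTs ts eqσ eqτ)

    subst-congTs : ∀ {n m j} {σ σ' : Atom → Tm m} {τ τ' : Fin n → Tm m} (ts : Vec (Tm n) j) →
      (∀ x → x ∈ atomsTs ts → σ x ≡ σ' x) → (∀ i → τ i ≡ τ' i) → substTs σ τ ts ≡ substTs σ' τ' ts
    subst-congTs [] eqσ eqτ = refl
    subst-congTs (t ∷ ts) eqσ eqτ =
      cong₂ _∷_ (subst-congT t (λ x m → eqσ x (∈-++⁺ˡ m)) eqτ)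
                (subst-congTs ts (λ x m → eqσ x (∈-++⁺ʳ (atomsT t) m)) eqτ)

  wk-commute : ∀ {m k} (σ : Atom → Tm k) (τ : Fin m → Tm k) (t : Tm m) →
    substT (λ a → wkT (σ a)) (liftB τ) (wkT t) ≡ wkT (substT σ τ t)
  wk-commute σ τ t = trans (subst-fusionT atom (λ i → bvar (suc i)) _ _ t)
                           (sym (subst-fusionT σ τ atom (λ i → bvar (suc i)) t))

  subst-congF : ∀ {n m} {σ σ' : Atom → Tm m} {τ τ' : Fin n → Tm m} (φ : Fm n) →
    (∀ x → x ∈ atomsF φ → σ x ≡ σ' x) → (∀ i → τ i ≡ τ' i) → substF σ τ φ ≡ substF σ' τ' φ
  subst-congF bot eqσ eqτ = refl
  subst-congF (eq t u) eqσ eqτ =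
    cong₂ eq (subst-congT t (λ x m → eqσ x (∈-++⁺ˡ m)) eqτ) (subst-congT u (λ x m → eqσ x (∈-++⁺ʳ (atomsT t) m)) eqτ)
  subst-congF (rel P ts) eqσ eqτ = cong (rel P) (subst-congTs ts eqσ eqτ)
  subst-congF (and φ ψ) eqσ eqτ =
    cong₂ and (subst-congF φ (λ x m → eqσ x (∈-++⁺ˡ m)) eqτ) (subst-congF ψ (λ x m → eqσ x (∈-++⁺ʳ (atomsF φ) m)) eqτ)
  subst-congF (neg φ) eqσ eqτ = cong neg (subst-congF φ eqσ eqτ)
  subst-congF {τ = τ} {τ'} (all φ) eqσ eqτ = cong all (subst-congF φ (λ x m → cong wkT (eqσ x m)) lifted)
    where
      lifted : ∀ i → liftB τ i ≡ liftB τ' i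
      lifted zero = refl
      lifted (suc i) = cong wkT (eqτ i)

  subst-fusionF : ∀ {n m k} (σ : Atom → Tm m) (τ : Fin n → Tm m) (σ' : Atom → Tm k) (τ' : Fin m → Tm k) (φ : Fm n) →
    substF σ' τ' (substF σ τ φ) ≡ substF (λ x → substT σ' τ' (σ x)) (λ i → substT σ' τ' (τ i)) φ
  subst-fusionF σ τ σ' τ' bot = refl
  subst-fusionF σ τ σ' τ' (eq t u) = cong₂ eq (subst-fusionT σ τ σ' τ' t) (subst-fusionT σ τ σ' τ' u)
  subst-fusionF σ τ σ' τ' (rel P ts) = cong (rel P) (subst-fusionTs σ τ σ' τ' ts)
  subst-fusionF σ τ σ' τ' (and φ ψ) = cong₂ and (subst-fusionF σ τ σ' τ' φ) (subst-fusionF σ τ σ' τ' ψ)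
  subst-fusionF σ τ σ' τ' (neg φ) = cong neg (subst-fusionF σ τ σ' τ' φ)
  subst-fusionF σ τ σ' τ' (all φ) =
    cong all (trans (subst-fusionF _ _ _ _ φ) (subst-congF φ (λ x _ → wk-commute σ' τ' (σ x)) lifted))
    where
      lifted : ∀ i → substT (λ a → wkT (σ' a)) (liftB τ') (liftB τ i) ≡ liftB (λ j → substT σ' τ' (τ j)) i
      lifted zero = refl
      lifted (suc i) = wk-commute σ' τ' (τ i)

  mutual
    subst-idT : ∀ {n} (t : Tm n) → substT atom bvar t ≡ t
    subst-idT (atom x) = refl
    subst-idT (bvar i) = refl
    subst-idT (fun f ts) = cong (fun f) (subst-idTs ts)

    subst-idTs : ∀ {n j} (ts : Vec (Tm n) j) → substTs atom bvar ts ≡ ts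
    subst-idTs [] = refl
    subst-idTs (t ∷ ts) = cong₂ _∷_ (subst-idT t) (subst-idTs ts)

  subst-idF : ∀ {n} (φ : Fm n) → substF atom bvar φ ≡ φ
  subst-idF bot = refl
  subst-idF (eq t u) = cong₂ eq (subst-idT t) (subst-idT u)
  subst-idF (rel P ts) = cong (rel P) (subst-idTs ts)
  subst-idF (and φ ψ) = cong₂ and (subst-idF φ) (subst-idF ψ)
  subst-idF (neg φ) = cong neg (subst-idF φ)
  subst-idF (all φ) = cong all (trans (subst-congF φ (λ _ _ → refl) lifted) (subst-idF φ))
    where
      lifted : ∀ {n} (i : Fin (suc n)) → liftB bvar i ≡ bvar i
      lifted zero = refl
      lifted (suc i) = refl

  mutual
    atoms-substT : ∀ {n m x y} (σ : Atom → Tm m) (τ : Fin n → Tm m) (t : Tm n) →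
      x ∈ atomsT t → y ∈ atomsT (σ x) → y ∈ atomsT (substT σ τ t)
    atoms-substT σ τ (atom x) (here refl) y∈ = y∈
    atoms-substT σ τ (fun f ts) x∈ y∈ = atoms-substTs σ τ ts x∈ y∈

    atoms-substTs : ∀ {n m j x y} (σ : Atom → Tm m) (τ : Fin n → Tm m) (ts : Vec (Tm n) j) →
      x ∈ atomsTs ts → y ∈ atomsT (σ x) → y ∈ atomsTs (substTs σ τ ts)
    atoms-substTs σ τ (t ∷ ts) x∈ y∈ with ∈-++⁻ (atomsT t) x∈
    ... | inj₁ x∈t = ∈-++⁺ˡ (atoms-substT σ τ t x∈t y∈)
    ... | inj₂ x∈ts = ∈-++⁺ʳ (atomsT (substT σ τ t)) (atoms-substTs σ τ ts x∈ts y∈)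

  atoms-substF : ∀ {n m x y} (σ : Atom → Tm m) (τ : Fin n → Tm m) (φ : Fm n) →
    x ∈ atomsF φ → y ∈ atomsT (σ x) → y ∈ atomsF (substF σ τ φ)
  atoms-substF σ τ (eq t u) x∈ y∈ with ∈-++⁻ (atomsT t) x∈
  ... | inj₁ x∈t = ∈-++⁺ˡ (atoms-substT σ τ t x∈t y∈)
  ... | inj₂ x∈u = ∈-++⁺ʳ (atomsT (substT σ τ t)) (atoms-substT σ τ u x∈u y∈)
  atoms-substF σ τ (rel P ts) x∈ y∈ = atoms-substTs σ τ ts x∈ y∈
  atoms-substF σ τ (and φ ψ) x∈ y∈ with ∈-++⁻ (atomsF φ) x∈
  ... | inj₁ x∈φ = ∈-++⁺ˡ (atoms-substF σ τ φ x∈φ y∈)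
  ... | inj₂ x∈ψ = ∈-++⁺ʳ (atomsF (substF σ τ φ)) (atoms-substF σ τ ψ x∈ψ y∈)
  atoms-substF σ τ (neg φ) x∈ y∈ = atoms-substF σ τ φ x∈ y∈
  atoms-substF {x = x} σ τ (all φ) x∈ y∈ =
    atoms-substF (λ a → wkT (σ a)) (liftB τ) φ x∈ (atoms-substT atom (λ i → bvar (suc i)) (σ x) y∈ (here refl))

  atomsL-∈ : ∀ {x φ} (Γ : List Pred) → φ ∈ Γ → x ∈ atomsF φ → x ∈ atomsL Γ
  atomsL-∈ (ψ ∷ Γ) (here refl) x∈ = ∈-++⁺ˡ x∈
  atomsL-∈ (ψ ∷ Γ) (there φ∈Γ) x∈ = ∈-++⁺ʳ (atomsF ψ) (atomsL-∈ Γ φ∈Γ x∈)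

  single : Atom → Term → Atom → Term
  single c r x = if ⌊ x ≟ c ⌋ then r else atom x

  bindAt : ∀ {n} → Atom → Atom → Tm (suc n)
  bindAt a x = if ⌊ x ≟ a ⌋ then bvar zero else atom x

  shift : ∀ {n} → Fin n → Tm (suc n)
  shift i = bvar (suc i)

  renT : (Atom → Atom) → Term → Term
  renT f = substT (λ x → atom (f x)) bvar

  renF : (Atom → Atom) → Pred → Pred
  renF f = substF (λ x → atom (f x)) bvar

  renBody : (Atom → Atom) → Fm 1 → Fm 1
  renBody f = substF (λ x → atom (f x)) (liftB bvar)

  renF-fusion : ∀ f g (φ : Pred) → renF f (renF g φ) ≡ renF (λ x → f (g x)) φ
  renF-fusion f g = subst-fusionF _ bvar _ bvar

  renF-cong : ∀ {f g} (φ : Pred) → (∀ x → x ∈ atomsF φ → f x ≡ g x) → renF f φ ≡ renF g φ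
  renF-cong φ eq-on = subst-congF φ (λ x x∈ → cong atom (eq-on x x∈)) (λ _ → refl)

  renT-fixes : ∀ {f} (t : Term) → (∀ x → x ∈ atomsT t → f x ≡ x) → renT f t ≡ t
  renT-fixes t fixes = trans (subst-congT t (λ x x∈ → cong atom (fixes x x∈)) (λ _ → refl)) (subst-idT t)

  single-fresh : ∀ c r (s : Term) → c ∉ atomsT s → substT (single c r) bvar s ≡ s
  single-fresh c r s c∉s = trans (subst-congT s (λ y y∈ → if-≟-diff r (atom y) (λ y≡c → c∉s (subst (_∈ atomsT s) y≡c y∈)))
                                               (λ _ → refl))
                                 (subst-idT s)

  single-∉ : ∀ {b c x} (r : Term) → b ≢ x → b ∉ atomsT r → b ∉ atomsT (single c r x)
  single-∉ {c = c} {x} r b≢x b∉r with x ≟ c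
  ... | yes _ = b∉r
  ... | no _ = λ { (here b≡x) → b≢x b≡x }

  inst-close : ∀ c φ r → inst (close c φ) r ≡ φ [ c ≔ r ]
  inst-close c φ r = trans (subst-fusionF (bindAt c) shift atom (λ _ → r) φ) (subst-congF φ pointwise (λ ()))
    where
      pointwise : ∀ x → x ∈ atomsF φ → substT atom (λ _ → r) (bindAt c x) ≡ single c r x
      pointwise x _ with x ≟ c
      ... | yes _ = refl
      ... | no _ = refl

  inst-wk : ∀ (r : Term) t → substT atom (λ _ → r) (wkT t) ≡ t
  inst-wk r t = trans (subst-fusionT atom shift atom (λ _ → r) t)
                      (trans (subst-congT t (λ _ _ → refl) (λ ())) (subst-idT t))

  inst-ren : ∀ f (ψ : Fm 1) r → renF f (inst ψ r) ≡ inst (renBody f ψ) (renT f r)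
  inst-ren f ψ r = trans (subst-fusionF atom (λ _ → r) (λ x → atom (f x)) bvar ψ)
    (trans (subst-congF ψ (λ _ _ → refl) pointwise)
           (sym (subst-fusionF (λ x → atom (f x)) (liftB bvar) atom (λ _ → renT f r) ψ)))
    where
      pointwise : ∀ i → renT f r ≡ substT atom (λ _ → renT f r) (liftB bvar i)
      pointwise zero = refl

  ren-close : ∀ f → Inj f → ∀ a φ → renF f (∀[ a ] φ) ≡ ∀[ f a ] (renF f φ)
  ren-close f inj a φ = cong all (trans (subst-fusionF (bindAt a) shift (λ x → atom (f x)) (liftB bvar) φ)
      (trans (subst-congF φ (λ x _ → pointwise x) (λ ()))
             (sym (subst-fusionF (λ x → atom (f x)) bvar (bindAt (f a)) shift φ))))
    where
      pointwise : ∀ x → substT (λ y → atom (f y)) (liftB bvar) (bindAt a x) ≡ bindAt (f a) (f x)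
      pointwise x with x ≟ a
      ... | yes refl = sym (if-≟-same (f x) (bvar zero) (atom (f x)))
      ... | no x≢a = sym (if-≟-diff (bvar zero) (atom (f x)) (λ e → x≢a (inj e)))

  alpha : ∀ {a b} (φ : Pred) → b ∉ atomsF φ → ∀[ a ] φ ≡ ∀[ b ] (swapF b a φ)
  alpha {a} {b} φ b∉φ = cong all (sym (trans (subst-fusionF _ bvar (bindAt b) shift φ)
                                             (subst-congF φ pointwise (λ ()))))
    where
      pointwise : ∀ x → x ∈ atomsF φ → bindAt b (swapA b a x) ≡ bindAt a x
      pointwise x x∈φ = cases (x ≟ a)
        where
          x≢b : x ≢ b
          x≢b x≡b = b∉φ (subst (_∈ atomsF φ) x≡b x∈φ)
          cases : Dec (x ≡ a) → bindAt b (swapA b a x) ≡ bindAt a x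
          cases (yes refl) = trans (cong (bindAt b) (swap-right b x)) (trans (if-≟-same b _ _) (sym (if-≟-same x _ _)))
          cases (no x≢a) = trans (cong (bindAt b) (swap-other x≢b x≢a)) (trans (if-≟-diff _ _ x≢b) (sym (if-≟-diff _ _ x≢a)))

  bind-fresh : ∀ {b} (t : Term) → b ∉ atomsT t → substT (bindAt b) shift t ≡ wkT t
  bind-fresh {b} t b∉t = subst-congT t (λ y y∈ → if-≟-diff _ _ (λ y≡b → b∉t (subst (_∈ atomsT t) y≡b y∈))) (λ _ → refl)

  single-under-binder : ∀ {b c} (r : Term) (ψ : Pred) → b ≢ c → b ∉ atomsT r →
    (∀[ b ] ψ) [ c ≔ r ] ≡ ∀[ b ] (ψ [ c ≔ r ])
  single-under-binder {b} {c} r ψ b≢c b∉r =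
    cong all (trans (subst-fusionF (bindAt b) shift (λ x → wkT (single c r x)) (liftB bvar) ψ)
      (trans (subst-congF ψ (λ x _ → pointwise x) (λ ()))
             (sym (subst-fusionF (single c r) bvar (bindAt b) shift ψ))))
    where
      pointwise : ∀ x → substT (λ y → wkT (single c r y)) (liftB bvar) (bindAt b x) ≡ substT (bindAt b) shift (single c r x)
      pointwise x with x ≟ b
      ... | yes refl = sym (trans (cong (substT (bindAt x) shift) (if-≟-diff r (atom x) b≢c)) (if-≟-same x _ _))
      ... | no x≢b = sym (bind-fresh (single c r x) (single-∉ r (λ b≡x → x≢b (sym b≡x)) b∉r))

  ren-single : ∀ f → Inj f → ∀ c r (φ : Pred) → renF f (φ [ c ≔ r ]) ≡ (renF f φ) [ f c ≔ renT f r ]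
  ren-single f inj c r φ = trans (subst-fusionF (single c r) bvar _ bvar φ)
      (trans (subst-congF φ (λ x _ → pointwise x) (λ ()))
             (sym (subst-fusionF _ bvar (single (f c) (renT f r)) bvar φ)))
    where
      pointwise : ∀ x → renT f (single c r x) ≡ single (f c) (renT f r) (f x)
      pointwise x with x ≟ c
      ... | yes refl = sym (if-≟-same (f x) _ _)
      ... | no x≢c = sym (if-≟-diff _ _ (λ e → x≢c (inj e)))

  swap-swap : ∀ {a b b'} (φ : Pred) → b ∉ atomsF φ → b' ∉ atomsF φ → swapF b b' (swapF b' a φ) ≡ swapF b a φ
  swap-swap {a} {b} {b'} φ b∉φ b'∉φ = trans (renF-fusion _ _ φ) (renF-cong φ pointwise)
    where
      pointwise : ∀ x → x ∈ atomsF φ → swapA b b' (swapA b' a x) ≡ swapA b a x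
      pointwise x x∈φ = cases (x ≟ a)
        where
          x≢b : x ≢ b
          x≢b x≡b = b∉φ (subst (_∈ atomsF φ) x≡b x∈φ)
          x≢b' : x ≢ b'
          x≢b' x≡b' = b'∉φ (subst (_∈ atomsF φ) x≡b' x∈φ)
          cases : Dec (x ≡ a) → swapA b b' (swapA b' a x) ≡ swapA b a x
          cases (yes refl) = trans (cong (swapA b b') (swap-right b' x)) (trans (swap-right b b') (sym (swap-right b x)))
          cases (no x≢a) = trans (cong (swapA b b') (swap-other x≢b' x≢a)) (trans (swap-other x≢b x≢b') (sym (swap-other x≢b x≢a)))

  swap-then-single : ∀ c a r χ → c ∉ atomsF χ → (swapF c a χ) [ c ≔ r ] ≡ χ [ a ≔ r ]
  swap-then-single c a r χ c∉χ = trans (subst-fusionF _ bvar (single c r) bvar χ) (subst-congF χ pointwise (λ ()))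
    where
      pointwise : ∀ x → x ∈ atomsF χ → single c r (swapA c a x) ≡ single a r x
      pointwise x x∈χ = cases (x ≟ a)
        where
          x≢c : x ≢ c
          x≢c x≡c = c∉χ (subst (_∈ atomsF χ) x≡c x∈χ)
          cases : Dec (x ≡ a) → single c r (swapA c a x) ≡ single a r x
          cases (yes refl) = trans (cong (single c r) (swap-right c x)) (trans (if-≟-same c r (atom c)) (sym (if-≟-same x r (atom x))))
          cases (no x≢a) = trans (cong (single c r) (swap-other x≢c x≢a)) (trans (if-≟-diff r (atom x) x≢c) (sym (if-≟-diff r (atom x) x≢a)))

  -- The eigenvariable of ∀R is renamed to an atom
  -- fresh for Γ', Δ', by post-composing with a swapping that is invisible on
  -- the side formulas.
  Maps : (Atom → Atom) → List Pred → List Pred → Set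
  Maps f Γ Γ' = ∀ {φ} → φ ∈ Γ → renF f φ ∈ Γ'

  maps-∷ : ∀ {f Γ Γ' ψ ψ'} → Maps f Γ Γ' → renF f ψ ≡ ψ' → Maps f (ψ ∷ Γ) (ψ' ∷ Γ')
  maps-∷ maps e (here refl) = here e
  maps-∷ maps e (there φ∈Γ) = there (maps φ∈Γ)

  swap-invisible : ∀ f b b'' (Γ Γ' : List Pred) → b ∉ atomsL Γ → b'' ∉ atomsL Γ' → Maps f Γ Γ' → Inj f →
    ∀ {φ} → φ ∈ Γ → renF (λ x → swapA (f b) b'' (f x)) φ ≡ renF f φ
  swap-invisible f b b'' Γ Γ' b∉Γ b''∉Γ' maps inj {φ} φ∈Γ = renF-cong φ λ x x∈φ → swap-other
      (λ e → b∉Γ (atomsL-∈ Γ φ∈Γ (subst (_∈ atomsF φ) (inj e) x∈φ)))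
      (λ e → b''∉Γ' (atomsL-∈ Γ' (maps φ∈Γ) (subst (_∈ atomsF (renF f φ)) e
          (atoms-substF (λ x → atom (f x)) bvar φ x∈φ (here refl)))))

  maps-agree : ∀ {f g Γ Γ'} → (∀ {φ} → φ ∈ Γ → renF g φ ≡ renF f φ) → Maps f Γ Γ' → Maps g Γ Γ'
  maps-agree {Γ' = Γ'} agree maps φ∈Γ = subst (_∈ Γ') (sym (agree φ∈Γ)) (maps φ∈Γ)

  unall : ∀ {n} {φ ψ : Fm (suc n)} → all φ ≡ all ψ → φ ≡ ψ
  unall refl = refl

  rename-derivation : ∀ {Γ Δ} → Γ ⊢ₛ Δ → (f : Atom → Atom) → Inj f → ∀ {Γ' Δ'} →
    Maps f Γ Γ' → Maps f Δ Δ' → Γ' ⊢ₛ Δ'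
  rename-derivation (ax φ∈Γ φ∈Δ) f inj mΓ mΔ = ax (mΓ φ∈Γ) (mΔ φ∈Δ)
  rename-derivation (botL ⊥∈Γ) f inj mΓ mΔ = botL (mΓ ⊥∈Γ)
  rename-derivation (andL m d) f inj mΓ mΔ = andL (mΓ m) (rename-derivation d f inj (maps-∷ (maps-∷ mΓ refl) refl) mΔ)
  rename-derivation (andR m d₁ d₂) f inj mΓ mΔ =
    andR (mΔ m) (rename-derivation d₁ f inj mΓ (maps-∷ mΔ refl)) (rename-derivation d₂ f inj mΓ (maps-∷ mΔ refl))
  rename-derivation (negL m d) f inj mΓ mΔ = negL (mΓ m) (rename-derivation d f inj mΓ (maps-∷ mΔ refl))
  rename-derivation (negR m d) f inj mΓ mΔ = negR (mΔ m) (rename-derivation d f inj (maps-∷ mΓ refl) mΔ)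
  rename-derivation (allL {ψ = ψ} m r d) f inj mΓ mΔ =
    allL (mΓ m) (renT f r) (rename-derivation d f inj (maps-∷ mΓ (inst-ren f ψ r)) mΔ)
  rename-derivation {Γ} {Δ} (allR {ψ = ψ} b m b∉Γ b∉Δ d) f inj {Γ'} {Δ'} mΓ mΔ =
      allR b'' (mΔ m) b''∉Γ' b''∉Δ' (rename-derivation d f' inj' mΓ'' mΔ'')
    where
      b'' : Atom
      b'' = fresh (atomsL Γ' ++ atomsL Δ')
      b''∉Γ' : b'' ∉ atomsL Γ'
      b''∉Γ' = ∉-++ˡ (atomsL Δ') (fresh-∉ (atomsL Γ' ++ atomsL Δ'))
      b''∉Δ' : b'' ∉ atomsL Δ'
      b''∉Δ' = ∉-++ʳ (atomsL Γ') (fresh-∉ (atomsL Γ' ++ atomsL Δ'))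
      f' : Atom → Atom
      f' x = swapA (f b) b'' (f x)
      inj' : Inj f'
      inj' e = inj (swap-injective (f b) b'' e)
      invisibleΔ : ∀ {φ} → φ ∈ Δ → renF f' φ ≡ renF f φ
      invisibleΔ = swap-invisible f b b'' Δ Δ' b∉Δ b''∉Δ' mΔ inj
      mΓ'' : Maps f' Γ Γ'
      mΓ'' = maps-agree (swap-invisible f b b'' Γ Γ' b∉Γ b''∉Γ' mΓ inj) mΓ
      eigen : renF f' (inst ψ (atom b)) ≡ inst (renBody f ψ) (atom b'')
      eigen = trans (inst-ren f' ψ (atom b)) (cong₂ inst (unall (invisibleΔ m)) (cong atom (swap-left (f b) b'')))
      mΔ'' : Maps f' (inst ψ (atom b) ∷ Δ) (inst (renBody f ψ) (atom b'') ∷ Δ')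
      mΔ'' = maps-∷ (maps-agree invisibleΔ mΔ) eigen
  rename-derivation (eqRefl r d) f inj mΓ mΔ = eqRefl (renT f r) (rename-derivation d f inj (maps-∷ mΓ refl) mΔ)
  rename-derivation (eqSubst {r = r} {s = s} e ψ m d) f inj {Γ'} mΓ mΔ =
    eqSubst (mΓ e) (renBody f ψ) (subst (_∈ Γ') (inst-ren f ψ r) (mΓ m))
            (rename-derivation d f inj (maps-∷ mΓ (inst-ren f ψ s)) mΔ)
  rename-derivation (cut φ d₁ d₂) f inj mΓ mΔ =
    cut (renF f φ) (rename-derivation d₁ f inj mΓ (maps-∷ mΔ refl)) (rename-derivation d₂ f inj (maps-∷ mΓ refl) mΔ)

  weaken : ∀ {Γ Δ Γ' Δ'} → Γ ⊢ₛ Δ → (∀ {φ} → φ ∈ Γ → φ ∈ Γ') → (∀ {φ} → φ ∈ Δ → φ ∈ Δ') → Γ' ⊢ₛ Δ'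
  weaken {Γ' = Γ'} {Δ'} d sub sub' = rename-derivation d (λ x → x) (λ e → e)
    (λ {φ} m → subst (_∈ Γ') (sym (subst-idF φ)) (sub m)) (λ {φ} m → subst (_∈ Δ') (sym (subst-idF φ)) (sub' m))

  swap-derivation : ∀ u v {φ ψ} → φ ⊢ ψ → swapF u v φ ⊢ swapF u v ψ
  swap-derivation u v d = rename-derivation d (swapA u v) (swap-injective u v)
    (λ { (here refl) → here refl }) (λ { (here refl) → here refl })

  ⊢-⊤ : ∀ θ → θ ⊢ ⊤'
  ⊢-⊤ θ = negR (here refl) (botL (here refl))

  ∧-elimˡ : ∀ φ ψ → and φ ψ ⊢ φ
  ∧-elimˡ φ ψ = andL (here refl) (ax (here refl) (here refl))

  ∧-elimʳ : ∀ φ ψ → and φ ψ ⊢ ψ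
  ∧-elimʳ φ ψ = andL (here refl) (ax (there (here refl)) (here refl))

  ∀-elim : ∀ ψ r → all ψ ⊢ inst ψ r
  ∀-elim ψ r = allL (here refl) r (ax (here refl) (here refl))

  excluded-middle : ∀ θ φ → θ ⊢ (φ ∨' neg φ)
  excluded-middle θ φ = negR (here refl) (andL (here refl) (negL (there (here refl)) (ax (here refl) (here refl))))

  non-contradiction : ∀ φ → and φ (neg φ) ⊢ bot
  non-contradiction φ = andL (here refl) (negL (there (here refl)) (ax (here refl) (here refl)))

  implication-intro : ∀ θ φ ψ → φ ⊢ ψ → θ ⊢ neg (and φ (neg ψ))
  implication-intro θ φ ψ d = negR (here refl) (andL (here refl) (negL (there (here refl))
    (weaken d (λ { (here refl) → here refl }) (λ { (here refl) → here refl }))))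

  ∀-modus-ponens : ∀ θ r φ ψ → inst θ r ≡ neg (and φ (neg ψ)) → and (all θ) φ ⊢ ψ
  ∀-modus-ponens θ r φ ψ e = andL (here refl) (allL (here refl) r
    (subst (λ χ → (χ ∷ all θ ∷ φ ∷ and (all θ) φ ∷ []) ⊢ₛ (ψ ∷ [])) (sym e)
      (negL (here refl) (andR (here refl) (ax (there (there (here refl))) (here refl))
        (negR (here refl) (ax (here refl) (there (there (here refl)))))))))

  eq-transport : ∀ s t ψ → and (eq s t) (inst ψ s) ⊢ inst ψ t
  eq-transport s t ψ = andL (here refl) (eqSubst (here refl) ψ (there (here refl)) (ax (here refl) (here refl)))

  eq-refl : ∀ θ u → θ ⊢ eq u u
  eq-refl θ u = eqRefl u (ax (here refl) (here refl))

  eq-sym : ∀ s t → eq s t ⊢ eq t s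
  eq-sym s t = eqRefl s (eqSubst (there (here refl)) (eq (bvar zero) (wkT s))
    (here (cong (eq s) (inst-wk s s)))
    (subst (λ u → (eq t u ∷ eq s s ∷ eq s t ∷ []) ⊢ₛ (eq t s ∷ [])) (sym (inst-wk t s))
      (ax (here refl) (here refl))))

  ⊤-∈ : ∀ {p} → IsFilter p → p ⊤'
  ⊤-∈ fp = IsFilter.up fp _ ⊤' (proj₂ (IsFilter.nonempty fp)) (⊢-⊤ _)

  theorem-∈ : ∀ {p φ} → IsFilter p → ⊤' ⊢ φ → p φ
  theorem-∈ fp d = IsFilter.up fp _ _ (⊤-∈ fp) d

  swap-commute : ∀ {u v b a} (φ : Pred) → b ≢ u → b ≢ v → swapF u v (swapF b a φ) ≡ swapF b (swapA u v a) (swapF u v φ)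
  swap-commute {u} {v} {b} {a} φ b≢u b≢v = trans (renF-fusion _ _ φ)
    (trans (renF-cong φ (λ x _ → trans (swap-conjugate (swapA u v) (swap-injective u v) b a x)
                                        (cong (λ z → swapA z (swapA u v a) (swapA u v x)) (swap-other b≢u b≢v))))
           (sym (renF-fusion _ _ φ)))

  swap-point : ∀ u v {p} → IsPoint p → IsPoint (swapP u v p)
  swap-point u v {p} (fp , prime) = record
    { nonempty = ⊤' , ⊤-∈ fp
    ; no-bot = IsFilter.no-bot fp
    ; up = λ φ φ' φ∈ d → IsFilter.up fp _ _ φ∈ (swap-derivation u v d)
    ; meet = λ φ φ' → IsFilter.meet fp _ _
    ; gen = gen
    } , λ φ₁ φ₂ → prime _ _
    where
      gen : ∀ a φ → N (λ b → swapP u v p (swapF b a φ)) → swapP u v p (∀[ a ] φ)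
      gen a φ (l , h) = subst p (sym (ren-close (swapA u v) (swap-injective u v) a φ))
        (IsFilter.gen fp (swapA u v a) (swapF u v φ) (l ++ u ∷ v ∷ [] , λ b b∉ →
          subst p (swap-commute φ (∉-∷-head (∉-++ʳ l b∉)) (∉-∷-head (∉-∷-tail (∉-++ʳ l b∉))))
                  (h b (∉-++ˡ _ b∉))))

  -- Consequence survives substitution inside a filter: from φ ⊢ φ' the
  -- filter contains ∀c.(φ → φ') by generalisation; instantiating at r
  -- gives φ[c:=r] → φ'[c:=r].
  up-subst : ∀ {p} → IsFilter p → ∀ c r φ φ' → p (φ [ c ≔ r ]) → φ ⊢ φ' → p (φ' [ c ≔ r ])
  up-subst {p} fp c r φ φ' φr∈ d = up _ _ (meet _ _ ∀imp∈ φr∈) (∀-modus-ponens (close c imp) r _ _ (inst-close c imp r))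
    where
      open IsFilter fp
      imp : Pred
      imp = neg (and φ (neg φ'))
      ∀imp∈ : p (∀[ c ] imp)
      ∀imp∈ = gen c imp ([] , λ b _ → theorem-∈ fp (implication-intro ⊤' _ _ (swap-derivation b c d)))

  -- Generalisation survives substitution: after α-converting ∀[a]φ to a
  -- name b' avoiding c and r, the substitution passes under the binder and
  -- the given cofinite family of instances is a family of swaps of the body.
  gen-subst : ∀ {p} → IsFilter p → ∀ c r a φ → N (λ b → p ((swapF b a φ) [ c ≔ r ])) → p ((∀[ a ] φ) [ c ≔ r ])
  gen-subst {p} fp c r a φ (l , h) = subst p (sym bind)
      (IsFilter.gen fp b' body (l ++ K , λ b b∉ → subst p (rename b (avoid (∉-++ʳ l b∉))) (h b (∉-++ˡ K b∉))))
    where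
      K : List Atom
      K = c ∷ atomsF φ ++ atomsT r
      Avoids : Atom → Set
      Avoids b = b ≢ c × b ∉ atomsF φ × b ∉ atomsT r
      avoid : ∀ {b} → b ∉ K → Avoids b
      avoid b∉ = ∉-∷-head b∉ , ∉-++ˡ _ (∉-∷-tail b∉) , ∉-++ʳ (atomsF φ) (∉-∷-tail b∉)
      b' : Atom
      b' = fresh K
      b'≢c : b' ≢ c
      b'≢c = proj₁ (avoid (fresh-∉ K))
      b'∉φ : b' ∉ atomsF φ
      b'∉φ = proj₁ (proj₂ (avoid (fresh-∉ K)))
      b'∉r : b' ∉ atomsT r
      b'∉r = proj₂ (proj₂ (avoid (fresh-∉ K)))
      body : Pred
      body = (swapF b' a φ) [ c ≔ r ]
      bind : (∀[ a ] φ) [ c ≔ r ] ≡ ∀[ b' ] body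
      bind = trans (cong (_[ c ≔ r ]) (alpha φ b'∉φ)) (single-under-binder r _ b'≢c b'∉r)
      rename : ∀ b → Avoids b → (swapF b a φ) [ c ≔ r ] ≡ swapF b b' body
      rename b (b≢c , b∉φ , b∉r) = sym (begin
          swapF b b' body
            ≡⟨ ren-single (swapA b b') (swap-injective b b') c r _ ⟩
          (swapF b b' (swapF b' a φ)) [ swapA b b' c ≔ renT (swapA b b') r ]
            ≡⟨ cong (λ χ → χ [ swapA b b' c ≔ renT (swapA b b') r ]) (swap-swap φ b∉φ b'∉φ) ⟩
          (swapF b a φ) [ swapA b b' c ≔ renT (swapA b b') r ]
            ≡⟨ cong₂ (λ c' r' → (swapF b a φ) [ c' ≔ r' ]) (swap-other (≢-sym b≢c) (≢-sym b'≢c))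
                     (renT-fixes r (λ x x∈r → swap-other (avoids-r b∉r x∈r) (avoids-r b'∉r x∈r))) ⟩
          (swapF b a φ) [ c ≔ r ] ∎)
        where
          open ≡-Reasoning
          avoids-r : ∀ {y x} → y ∉ atomsT r → x ∈ atomsT r → x ≢ y
          avoids-r y∉r x∈r x≡y = y∉r (subst (_∈ atomsT r) x≡y x∈r)

  subst-point : ∀ c r {p} → IsPoint p → IsPoint (p [ r ⇐ c ])
  subst-point c r {p} (fp , prime) = record
    { nonempty = ⊤' , ⊤-∈ fp
    ; no-bot = IsFilter.no-bot fp
    ; up = up-subst fp c r
    ; meet = λ φ φ' → IsFilter.meet fp _ _
    ; gen = gen-subst fp c r
    } , λ φ₁ φ₂ → prime _ _

  Represents : PtSet → Pred → Set₁
  Represents X χ = ∀ q → X q ⇔ (IsPoint q × q χ)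

  -- Semantic substitution lemma: X[a:=r] represents χ[a:=r].  For c fresh
  -- for χ, the point (c a)·(q[r⇐c]) contains χ iff q contains
  -- ((c a)·χ)[c:=r] = χ[a:=r].
  represents-subst : ∀ {X χ} a r → Represents X χ → Represents (X [ a ≔ₓ r ]) (χ [ a ≔ r ])
  represents-subst {X} {χ} a r rep q = mk⇔ toward back
    where
      toward : (X [ a ≔ₓ r ]) q → IsPoint q × q (χ [ a ≔ r ])
      toward (pt , (l , h)) =
        pt , subst q (swap-then-single c a r χ (∉-++ʳ l (fresh-∉ L))) (proj₂ (to (rep _) (h c (∉-++ˡ _ (fresh-∉ L)))))
        where
          L : List Atom
          L = l ++ atomsF χ
          c : Atom
          c = fresh L
      back : IsPoint q × q (χ [ a ≔ r ]) → (X [ a ≔ₓ r ]) q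
      back (pt , χr∈q) = pt , (atomsF χ , λ c c∉χ →
        from (rep _) (swap-point c a (subst-point c r pt) , subst q (sym (swap-then-single c a r χ c∉χ)) χr∈q))

  substAllₓ : PtSet → List (Atom × Term) → PtSet
  substAllₓ = foldl (λ X ar → X [ proj₁ ar ≔ₓ proj₂ ar ])

  substAllᶠ : Pred → List (Atom × Term) → Pred
  substAllᶠ = foldl (λ χ ar → χ [ proj₁ ar ≔ proj₂ ar ])

  substAllᵗ : List (Atom × Term) → Term → Term
  substAllᵗ ps t = foldl (λ s ar → substT (single (proj₁ ar) (proj₂ ar)) bvar s) t ps

  represents-substAll : ∀ ps {X χ} → Represents X χ → Represents (substAllₓ X ps) (substAllᶠ χ ps)
  represents-substAll [] rep = rep
  represents-substAll ((a , r) ∷ ps) rep = represents-substAll ps (represents-subst a r rep)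

  substTs-map : ∀ {k} (σ : Atom → Term) (us : Vec Term k) → substTs σ bvar us ≡ map (substT σ bvar) us
  substTs-map σ [] = refl
  substTs-map σ (u ∷ us) = cong (_ ∷_) (substTs-map σ us)

  substAll-rel : ∀ ps (P : PredSym) (us : Vec Term (parity P)) → substAllᶠ (rel P us) ps ≡ rel P (map (substAllᵗ ps) us)
  substAll-rel [] P us = cong (rel P) (sym (map-id us))
  substAll-rel ((a , r) ∷ ps) P us = trans (substAll-rel ps P (substTs (single a r) bvar us))
    (cong (rel P) (trans (cong (map (substAllᵗ ps)) (substTs-map (single a r) us))
                         (sym (map-∘ (substAllᵗ ps) (substT (single a r) bvar) us))))

  range : Atom → (k : ℕ) → Vec Atom k
  range m zero = []
  range m (suc k) = m ∷ range (suc m) k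

  tabulate-range : ∀ k m → tabulate {n = k} (λ i → m + toℕ i) ≡ range m k
  tabulate-range zero m = refl
  tabulate-range (suc k) m = cong₂ _∷_ (+-identityʳ m) (trans (tabulate-cong (λ i → +-suc m (toℕ i))) (tabulate-range k (suc m)))

  map-range-cong : ∀ {B : Set} k m {f g : Atom → B} → (∀ x → m ≤ x → f x ≡ g x) → map f (range m k) ≡ map g (range m k)
  map-range-cong zero m eq-above = refl
  map-range-cong (suc k) m eq-above =
    cong₂ _∷_ (eq-above m ≤-refl) (map-range-cong k (suc m) (λ x m<x → eq-above x (≤-trans (n≤1+n m) m<x)))

  substAll-below : ∀ k m (rs : Vec Term k) t → (∀ y → y ∈ atomsT t → y < m) →
    substAllᵗ (zip (toList (range m k)) (toList rs)) t ≡ t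
  substAll-below zero m [] t below = refl
  substAll-below (suc k) m (r ∷ rs) t below =
    trans (cong (substAllᵗ (zip (toList (range (suc m) k)) (toList rs))) (single-fresh m r t (λ m∈t → <⇒≢ (below m m∈t) refl)))
          (substAll-below k (suc m) rs t (λ y y∈t → m<n⇒m<1+n (below y y∈t)))

  substAll-range : ∀ k m (rs : Vec Term k) → (∀ y → y ∈ atomsTs rs → y < m) →
    map (λ x → substAllᵗ (zip (toList (range m k)) (toList rs)) (atom x)) (range m k) ≡ rs
  substAll-range zero m [] below = refl
  substAll-range (suc k) m (r ∷ rs) below = cong₂ _∷_
    (trans (cong (substAllᵗ ps) (if-≟-same m r (atom m)))
           (substAll-below k (suc m) rs r (λ y y∈r → m<n⇒m<1+n (below y (∈-++⁺ˡ y∈r)))))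
    (trans (map-range-cong k (suc m) (λ x m<x → cong (substAllᵗ ps) (if-≟-diff r (atom x) (≢-sym (<⇒≢ m<x)))))
           (substAll-range k (suc m) rs (λ y y∈rs → m<n⇒m<1+n (below y (∈-++⁺ʳ (atomsT r) y∈rs)))))
    where
      ps : List (Atom × Term)
      ps = zip (toList (range (suc m) k)) (toList rs)

  -- P^I(r₁,…,rₖ) represents P(r₁,…,rₖ): iterate the substitution lemma along
  -- the fresh atoms aᵢ, starting from P^I(a₁,…,aₖ), which represents P(a₁,…,aₖ).
  PI-represents : ∀ P (rs : Vec Term (parity P)) → Represents (PI P rs) (rel P rs)
  PI-represents P rs = subst (Represents (PI P rs)) instantiated (represents-substAll ps (λ q → mk⇔ (λ x → x) (λ x → x)))
    where
      m : Atom
      m = fresh (atomsTs rs)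
      k : ℕ
      k = parity P
      atoms-of : Vec Atom k → List (Atom × Term)
      atoms-of v = zip (toList v) (toList rs)
      ps : List (Atom × Term)
      ps = atoms-of (tabulate (λ i → m + toℕ i))
      instantiated : substAllᶠ (rel P (map atom (tabulate (λ i → m + toℕ i)))) ps ≡ rel P rs
      instantiated = begin
          substAllᶠ (rel P (map atom (tabulate (λ i → m + toℕ i)))) ps
            ≡⟨ cong (λ v → substAllᶠ (rel P (map atom v)) (atoms-of v)) (tabulate-range k m) ⟩
          substAllᶠ (rel P (map atom (range m k))) (atoms-of (range m k))
            ≡⟨ substAll-rel (atoms-of (range m k)) P (map atom (range m k)) ⟩
          rel P (map (substAllᵗ (atoms-of (range m k))) (map atom (range m k)))
            ≡⟨ cong (rel P) (sym (map-∘ (substAllᵗ (atoms-of (range m k))) atom (range m k))) ⟩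
          rel P (map (λ x → substAllᵗ (atoms-of (range m k)) (atom x)) (range m k))
            ≡⟨ cong (rel P) (substAll-range k m rs (λ y y∈rs → fresh-> (atomsTs rs) y∈rs)) ⟩
          rel P rs ∎
        where open ≡-Reasoning

  bot-represents : Represents (λ _ → ⊥) bot
  bot-represents q = mk⇔ ⊥-elim (λ (pt , ⊥∈q) → IsFilter.no-bot (proj₁ pt) ⊥∈q)

  and-represents : ∀ {X Y χ θ} → Represents X χ → Represents Y θ → Represents (λ q → X q × Y q) (and χ θ)
  and-represents {χ = χ} {θ} repX repY q = mk⇔
    (λ (x , y) → let (pt , χ∈q) = to (repX q) x in pt , IsFilter.meet (proj₁ pt) _ _ χ∈q (proj₂ (to (repY q) y)))
    (λ (pt , ∧∈q) → from (repX q) (pt , IsFilter.up (proj₁ pt) _ _ ∧∈q (∧-elimˡ χ θ))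
                  , from (repY q) (pt , IsFilter.up (proj₁ pt) _ _ ∧∈q (∧-elimʳ χ θ)))

  -- A prime filter contains χ or ¬χ, since it contains the theorem χ ∨ ¬χ.
  neg-represents : ∀ {X χ} → Represents X χ → Represents (λ q → IsPoint q × ¬ X q) (neg χ)
  neg-represents {X} {χ} rep q = mk⇔ toward back
    where
      toward : IsPoint q × ¬ X q → IsPoint q × q (neg χ)
      toward (pt , q∉X) with proj₂ pt χ (neg χ) (theorem-∈ (proj₁ pt) (excluded-middle ⊤' χ))
      ... | inj₁ χ∈q = ⊥-elim (q∉X (from (rep q) (pt , χ∈q)))
      ... | inj₂ ¬χ∈q = pt , ¬χ∈q
      back : IsPoint q × q (neg χ) → IsPoint q × ¬ X q
      back (pt , ¬χ∈q) = pt , λ q∈X → IsFilter.no-bot (proj₁ pt)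
        (IsFilter.up (proj₁ pt) _ _ (IsFilter.meet (proj₁ pt) _ _ (proj₂ (to (rep q) q∈X)) ¬χ∈q) (non-contradiction χ))

  eq-instance : ∀ c s u → c ∉ atomsT u → (eq (atom c) u) [ c ≔ s ] ≡ eq s u
  eq-instance c s u c∉u = cong₂ eq (if-≟-same c s (atom c)) (single-fresh c s u c∉u)

  -- q[t⇐c] and q[u⇐c] agree for cofinitely many c iff t = u ∈ q: test them
  -- on c = u for a fresh c, and conversely transport along t = u.
  eq-represents : ∀ t u → Represents (λ q → IsPoint q × N (λ c → ∀ ψ → (q [ t ⇐ c ]) ψ ⇔ (q [ u ⇐ c ]) ψ)) (eq t u)
  eq-represents t u q = mk⇔ toward back
    where
      toward : IsPoint q × N (λ c → ∀ ψ → (q [ t ⇐ c ]) ψ ⇔ (q [ u ⇐ c ]) ψ) → IsPoint q × q (eq t u)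
      toward (pt , (l , agree)) = pt , subst q (eq-instance c t u c∉u)
          (from (agree c c∉l (eq (atom c) u)) (subst q (sym (eq-instance c u u c∉u)) (theorem-∈ (proj₁ pt) (eq-refl ⊤' u))))
        where
          L : List Atom
          L = l ++ atomsT t ++ atomsT u
          c : Atom
          c = fresh L
          c∉l : c ∉ l
          c∉l = ∉-++ˡ _ (fresh-∉ L)
          c∉u : c ∉ atomsT u
          c∉u = ∉-++ʳ (atomsT t) (∉-++ʳ l (fresh-∉ L))
      transport : IsPoint q → ∀ s w c ψ → q (eq s w) → q (ψ [ c ≔ s ]) → q (ψ [ c ≔ w ])
      transport (fq , _) s w c ψ sw∈q ψs∈q = subst q (inst-close c ψ w) (IsFilter.up fq _ _
          (IsFilter.meet fq _ _ sw∈q (subst q (sym (inst-close c ψ s)) ψs∈q)) (eq-transport s w (close c ψ)))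
      back : IsPoint q × q (eq t u) → IsPoint q × N (λ c → ∀ ψ → (q [ t ⇐ c ]) ψ ⇔ (q [ u ⇐ c ]) ψ)
      back (pt , tu∈q) = pt , ([] , λ c _ ψ →
        mk⇔ (transport pt t u c ψ tu∈q) (transport pt u t c ψ (IsFilter.up (proj₁ pt) _ _ tu∈q (eq-sym t u))))

  named : ∀ {n} → (Fin n → Atom) → Fm n → Pred
  named ρ = substF atom (λ i → atom (ρ i))

  env-∈ : ∀ {n} (ρ : Fin n → Atom) i → ρ i ∈ envAtoms ρ
  env-∈ ρ zero = here refl
  env-∈ ρ (suc i) = there (env-∈ (λ j → ρ (suc j)) i)

  module NamedBinder {n} (φ : Fm (suc n)) (ρ : Fin n → Atom) (a : Atom) (a∉φ : a ∉ atomsF φ) (ρ≢a : ∀ i → ρ i ≢ a) where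
    body : Fm 1
    body = substF atom (liftB (λ i → atom (ρ i))) φ

    χ : Pred
    χ = named (extEnv a ρ) φ

    x≢a : ∀ {x} → x ∈ atomsF φ → x ≢ a
    x≢a x∈φ x≡a = a∉φ (subst (_∈ atomsF φ) x≡a x∈φ)

    close-named : close a χ ≡ body
    close-named = trans (subst-fusionF atom (λ i → atom (extEnv a ρ i)) (bindAt a) shift φ)
                        (subst-congF φ (λ x x∈φ → if-≟-diff _ _ (x≢a x∈φ)) bound)
      where
        bound : ∀ i → bindAt a (extEnv a ρ i) ≡ liftB (λ j → atom (ρ j)) i
        bound zero = if-≟-same a _ _
        bound (suc i) = if-≟-diff _ _ (ρ≢a i)

    instantiate : ∀ (σ : Atom → Term) r → σ a ≡ r → (∀ x → x ∈ atomsF φ → σ x ≡ atom x) →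
      (∀ i → σ (ρ i) ≡ atom (ρ i)) → substF σ bvar χ ≡ inst body r
    instantiate σ r σa≡r σ-fixes-φ σ-fixes-ρ =
      trans (subst-fusionF atom (λ i → atom (extEnv a ρ i)) σ bvar φ)
            (trans (subst-congF φ σ-fixes-φ bound) (sym (subst-fusionF atom (liftB (λ i → atom (ρ i))) atom (λ _ → r) φ)))
      where
        bound : ∀ i → σ (extEnv a ρ i) ≡ substT atom (λ _ → r) (liftB (λ j → atom (ρ j)) i)
        bound zero = σa≡r
        bound (suc i) = σ-fixes-ρ i

    instantiate-single : ∀ r → χ [ a ≔ r ] ≡ inst body r
    instantiate-single r = instantiate (single a r) r (if-≟-same a r _)
      (λ x x∈φ → if-≟-diff r _ (x≢a x∈φ)) (λ i → if-≟-diff r _ (ρ≢a i))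

    instantiate-swap : ∀ b → b ∉ atomsF φ ++ envAtoms ρ → swapF b a χ ≡ inst body (atom b)
    instantiate-swap b b∉ = instantiate (λ x → atom (swapA b a x)) (atom b) (cong atom (swap-right b a))
      (λ x x∈φ → cong atom (swap-other (λ x≡b → ∉-++ˡ _ b∉ (subst (_∈ atomsF φ) x≡b x∈φ)) (x≢a x∈φ)))
      (λ i → cong atom (swap-other (λ ρi≡b → ∉-++ʳ (atomsF φ) b∉ (subst (_∈ envAtoms ρ) ρi≡b (env-∈ ρ i))) (ρ≢a i)))

  -- ∀: ⟦∀φ⟧ρ = ⋂ᵣ X[a:=r] with X representing χ = φ named by a; each X[a:=r]
  -- represents χ[a:=r], so membership for all r is the generalisation axiom
  -- (using r = b for cofinitely many atoms b) and conversely ∀-elimination.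
  all-represents : ∀ {n} (φ : Fm (suc n)) (ρ : Fin n → Atom) →
    Represents (⟦ φ ⟧ (extEnv (fresh (atomsF φ ++ envAtoms ρ)) ρ)) (named (extEnv (fresh (atomsF φ ++ envAtoms ρ)) ρ) φ) →
    Represents (⟦ all φ ⟧ ρ) (named ρ (all φ))
  all-represents φ ρ rep q = mk⇔ toward back
    where
      L : List Atom
      L = atomsF φ ++ envAtoms ρ
      a : Atom
      a = fresh L
      open NamedBinder φ ρ a (∉-++ˡ _ (fresh-∉ L))
        (λ i ρi≡a → ∉-++ʳ (atomsF φ) (fresh-∉ L) (subst (_∈ envAtoms ρ) ρi≡a (env-∈ ρ i)))
      instances : ∀ r → Represents ((⟦ φ ⟧ (extEnv a ρ)) [ a ≔ₓ r ]) (inst body r)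
      instances r = subst (Represents _) (instantiate-single r) (represents-subst a r rep)
      toward : ⟦ all φ ⟧ ρ q → IsPoint q × q (all body)
      toward q∈ = pt , subst q (cong all close-named) (IsFilter.gen (proj₁ pt) a χ (L , λ b b∉L →
          subst q (sym (instantiate-swap b b∉L)) (proj₂ (to (instances (atom b) q) (q∈ (atom b))))))
        where
          pt : IsPoint q
          pt = proj₁ (to (instances (atom 0) q) (q∈ (atom 0)))
      back : IsPoint q × q (all body) → ⟦ all φ ⟧ ρ q
      back (pt , ∀∈q) r = from (instances r q) (pt , IsFilter.up (proj₁ pt) _ _ ∀∈q (∀-elim body r))

  truth : ∀ {n} (φ : Fm n) (ρ : Fin n → Atom) → Represents (⟦ φ ⟧ ρ) (named ρ φ)
  truth bot ρ = bot-represents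
  truth (eq t u) ρ = eq-represents (envT ρ t) (envT ρ u)
  truth (rel P ts) ρ = PI-represents P (envTs ρ ts)
  truth (and φ ψ) ρ = and-represents (truth φ ρ) (truth ψ ρ)
  truth (neg φ) ρ = neg-represents (truth φ ρ)
  truth (all φ) ρ = all-represents φ ρ (truth φ _)

  truth-closed : ∀ (ρ : Fin 0 → Atom) (φ : Pred) → Represents (⟦ φ ⟧ ρ) φ
  truth-closed ρ φ = subst (Represents (⟦ φ ⟧ ρ)) (trans (subst-congF φ (λ _ _ → refl) (λ ())) (subst-idF φ)) (truth φ ρ)

theorem7p30 : (S : Signature) → let open Logic S in
    (φ : Pred) (p : PSet) → ⟦ φ ⟧ᵖ p ⇔ (IsPoint p × p φ)
theorem7p30 S φ p = TruthLemma.truth-closed S _ φ p
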